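{- If there is a NOF permutation problem $I\subset[N]\times[N]\times[N]$ with NOF communication complexity $\mathrm{cc}(\tilde I,P_{NOF})\le k$, then $Q_{zo}(\langle N,N,N\rangle)\ge N^2 2^{ -k}$.
   Context: A NOF permutation problem over $[N]$ is $I\subset[N]^3$ such that for any two coordinates there is exactly one value of the third giving a triple of $I$. It is viewed as a three-player promise problem over alphabet $[N]^2$ with promise $P_{NOF}=\{((i,j),(j,k),(k,i))\}$ (the support of $\langle N,N,N\rangle=\sum_{i,j,k}x_{i,j}y_{j,k}z_{k,i}$) and accepting set $\tilde I=\{((x,y),(y,z),(z,x)):(x,y,z)\in I\}$; players receive $a,b,c$ with $(a,b,c)\in P_{NOF}$ and decide membership in $\tilde I$. $\mathrm{cc}$ is deterministic communication complexity in the shared-blackboard model (players in cyclic order append bits depending on own input and the board, or accept/reject; input accepted iff all accept; correctness only on the promise; cost = maximum number of bits written). $Q_{zo}(T)$ is the maximum $k$ such that some zeroing out of $T$ (setting all coefficients outside some $A'\times B'\times C'$ to zero) is a tensor whose support has $k$ elements with every index on each axis occurring in at most one of them. -}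

module Defs where

open import Data.Nat using (ℕ; zero; suc; _+_; _*_; _^_; _≤_; _⊔_; _≡ᵇ_)
open import Data.Bool using (Bool; true; false; _∧_; not; if_then_else_)
open import Data.Fin using (Fin; toℕ; zero; suc)
open import Data.List using (List; length; filterᵇ; cartesianProduct; allFin)
open import Data.Product using (Σ; ∃; _×_; _,_; proj₁; proj₂)
open import Data.Sum using (_⊎_)
open import Relation.Binary.PropositionalEquality using (_≡_; _≢_)

-- The alphabet [N]^2 (indices are Fin N, i.e. 0..N-1 instead of 1..N).
Sq : ℕ → Set
Sq N = Fin N × Fin N

_=ᶠ_ : ∀ {N} → Fin N → Fin N → Bool
i =ᶠ j = toℕ i ≡ᵇ toℕ j

Subset3 : ℕ → Set
Subset3 N = Fin N → Fin N → Fin N → Bool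

ExactlyOne : ∀ {N} → (Fin N → Bool) → Set
ExactlyOne {N} P = Σ (Fin N) λ z → (P z ≡ true) × (∀ z' → P z' ≡ true → z' ≡ z)

IsNOFPermutationProblem : ∀ {N} → Subset3 N → Set
IsNOFPermutationProblem {N} I =
  (∀ x y → ExactlyOne (λ z → I x y z)) ×
  (∀ y z → ExactlyOne (λ x → I x y z)) ×
  (∀ x z → ExactlyOne (λ y → I x y z))

PNOF : ∀ {N} → Sq N → Sq N → Sq N → Set
PNOF a b c = (proj₂ a ≡ proj₁ b) × (proj₂ b ≡ proj₁ c) × (proj₂ c ≡ proj₁ a)

tildeI : ∀ {N} → Subset3 N → Sq N → Sq N → Sq N → Set
tildeI {N} I a b c = Σ (Fin N) λ x → Σ (Fin N) λ y → Σ (Fin N) λ z →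
  (a ≡ (x , y)) × (b ≡ (y , z)) × (c ≡ (z , x)) × (I x y z ≡ true)

-- Player p : Fin 3 holds input a, b or c respectively.  At an internal node the current player appends one
-- bit computed from its own input (the board = path so far is implicit
-- in the tree).

nextP : Fin 3 → Fin 3
nextP zero = suc zero
nextP (suc zero) = suc (suc zero)
nextP (suc (suc zero)) = zero

data Protocol (N : ℕ) : Fin 3 → Set where
  leaf : ∀ {p} → (Sq N → Bool) → (Sq N → Bool) → (Sq N → Bool) → Protocol N p
  node : ∀ {p} → (Sq N → Bool) → (on0 on1 : Protocol N (nextP p)) → Protocol N p

select : ∀ {A : Set} → Fin 3 → A → A → A → A
select zero a b c = a
select (suc zero) a b c = b
select (suc (suc zero)) a b c = c

run : ∀ {N p} → Protocol N p → Sq N → Sq N → Sq N → Bool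
run (leaf f g h) a b c = f a ∧ g b ∧ h c
run {p = p} (node s π₀ π₁) a b c =
  if s (select p a b c) then run π₁ a b c else run π₀ a b c

cost : ∀ {N p} → Protocol N p → ℕ
cost (leaf _ _ _) = 0
cost (node _ π₀ π₁) = suc (cost π₀ ⊔ cost π₁)

Correct : ∀ {N p} → Protocol N p → (Prom Acc : Sq N → Sq N → Sq N → Set) → Set
Correct {N} π Prom Acc = ∀ (a b c : Sq N) → Prom a b c →
  ((run π a b c ≡ true → Acc a b c) × (Acc a b c → run π a b c ≡ true))

CCAtMost : ∀ {N} → (Prom Acc : Sq N → Sq N → Sq N → Set) → ℕ → Set
CCAtMost {N} Prom Acc k =
  Σ (Protocol N zero) λ π → Correct π Prom Acc × (cost π ≤ k)

-- Tensors on [N]^2 ⊗ [N]^2 ⊗ [N]^2 (coefficients in ℕ; only the support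
-- matters) and the matrix multiplication tensor ⟨N,N,N⟩.

Tensor : ℕ → Set
Tensor N = Sq N → Sq N → Sq N → ℕ

matMul : (N : ℕ) → Tensor N
matMul N a b c =
  if (proj₂ a =ᶠ proj₁ b) ∧ (proj₂ b =ᶠ proj₁ c) ∧ (proj₂ c =ᶠ proj₁ a)
  then 1 else 0

zeroOut : ∀ {N} → Tensor N → (A' B' C' : Sq N → Bool) → Tensor N
zeroOut T A' B' C' a b c = if A' a ∧ B' b ∧ C' c then T a b c else 0

allSq : (N : ℕ) → List (Sq N)
allSq N = cartesianProduct (allFin N) (allFin N)

allTriples : (N : ℕ) → List (Sq N × Sq N × Sq N)
allTriples N = cartesianProduct (allSq N) (cartesianProduct (allSq N) (allSq N))

supportSize : ∀ {N} → Tensor N → ℕ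
supportSize {N} T =
  length (filterᵇ (λ t → not (T (proj₁ t) (proj₁ (proj₂ t)) (proj₂ (proj₂ t)) ≡ᵇ 0))
                  (allTriples N))

IsFreeDiagonal : ∀ {N} → Tensor N → Set
IsFreeDiagonal T = ∀ a b c a' b' c' → T a b c ≢ 0 → T a' b' c' ≢ 0 →
  (a ≡ a' ⊎ b ≡ b' ⊎ c ≡ c') → (a ≡ a' × b ≡ b' × c ≡ c')

-- Q_zo(T) ≥ m, stated with the real bound m = num / den cleared:
-- some zeroing out is a free diagonal with support size s, s * den ≥ num.
QzoAtLeastFrac : ∀ {N} → Tensor N → (num den : ℕ) → Set
QzoAtLeastFrac {N} T num den = Σ (Sq N → Bool) λ A' → Σ (Sq N → Bool) λ B' → Σ (Sq N → Bool) λ C' →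
  IsFreeDiagonal (zeroOut T A' B' C') × (num ≤ supportSize (zeroOut T A' B' C') * den)

-- Induction on the protocol, following at each node the child whose accepting
-- rectangle holds more of the inputs, gives a rectangle A′ × B′ × C′ on which a
-- cost-k protocol accepts and which contains a 2^-k fraction of any list of
-- inputs it accepts.  Apply this to the N² inputs ((x,y),(y,z),(z,x)) with
-- (x,y,z) ∈ I and zero ⟨N,N,N⟩ out to that rectangle: those terms survive, and
-- every surviving term lies in the promise, hence by correctness in Ĩ.  As I is
-- a permutation problem, two triples of Ĩ sharing a coordinate coincide, so the
-- zeroed-out tensor is a free diagonal.
module Submission where

open import Defs
open import Data.Nat using (ℕ; zero; suc; _+_; _*_; _^_; _≤_; _⊔_; _≡ᵇ_; z≤n; s≤s)
open import Data.Bool using (Bool; true; false; _∧_; not; if_then_else_)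
open import Data.Bool.Properties using (∧-comm; ∧-zeroʳ; ∧-conicalˡ; ∧-conicalʳ; T-≡)
open import Data.Empty using (⊥-elim)
open import Data.Fin using (Fin; toℕ; zero; suc)
open import Data.Fin.Properties using (toℕ-injective)
open import Data.List using (List; []; _∷_; length; filterᵇ; map; _++_; cartesianProduct; allFin)
open import Data.List.Properties using (length-++; length-map; length-tabulate; filter-++)
open import Data.List.Membership.Propositional using (_∈_)
open import Data.List.Membership.Propositional.Properties
  using (∈-allFin; ∈-map⁺; ∈-cartesianProduct⁺)
open import Data.List.Relation.Unary.Any using (here; there)
open import Data.Nat.Properties
open import Data.Product using (Σ; _×_; _,_; proj₁; proj₂)
open import Data.Sum using (_⊎_; inj₁; inj₂)
open import Function using (_∘_; id; Equivalence)
open import Relation.Binary.PropositionalEquality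

module _ {A : Set} where

  count : (A → Bool) → List A → ℕ
  count p xs = length (filterᵇ p xs)

  count-cong : {p q : A → Bool} → (∀ x → p x ≡ q x) → ∀ xs → count p xs ≡ count q xs
  count-cong p≗q [] = refl
  count-cong {p} {q} p≗q (x ∷ xs) with p x | q x | p≗q x
  ... | true  | true  | _ = cong suc (count-cong p≗q xs)
  ... | false | false | _ = count-cong p≗q xs

  count-all : {p : A → Bool} → (∀ x → p x ≡ true) → ∀ xs → count p xs ≡ length xs
  count-all p≡true [] = refl
  count-all {p} p≡true (x ∷ xs) with p x | p≡true x
  ... | true | _ = cong suc (count-all p≡true xs)

  count-filterᵇ : ∀ (q r : A → Bool) xs → count q (filterᵇ r xs) ≡ count (λ x → q x ∧ r x) xs
  count-filterᵇ q r [] = refl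
  count-filterᵇ q r (x ∷ xs) with r x
  ... | false rewrite ∧-zeroʳ (q x) = count-filterᵇ q r xs
  ... | true with q x
  ...   | true  = cong suc (count-filterᵇ q r xs)
  ...   | false = count-filterᵇ q r xs

  count-if : ∀ (q u v : A → Bool) xs →
    count (λ x → if q x then u x else v x) xs ≡ count v (filterᵇ (not ∘ q) xs) + count u (filterᵇ q xs)
  count-if q u v [] = refl
  count-if q u v (x ∷ xs) with q x
  ... | true with u x
  ...   | true  = trans (cong suc (count-if q u v xs)) (sym (+-suc _ _))
  ...   | false = count-if q u v xs
  count-if q u v (x ∷ xs) | false with v x
  ...   | true  = cong suc (count-if q u v xs)
  ...   | false = count-if q u v xs

  count-++ : ∀ (p : A → Bool) xs ys → count p (xs ++ ys) ≡ count p xs + count p ys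
  count-++ p xs ys = trans (cong length (filter-++ _ xs ys)) (length-++ (filterᵇ p xs))

  count-∈ : ∀ (p : A → Bool) {x xs} → x ∈ xs → p x ≡ true → 1 ≤ count p xs
  count-∈ p {xs = y ∷ xs} (here refl) px with p y
  ... | true = s≤s z≤n
  count-∈ p {xs = y ∷ xs} (there x∈xs) px with p y
  ... | true  = s≤s z≤n
  ... | false = count-∈ p x∈xs px

module _ {A B : Set} where

  length-cartesianProduct : ∀ (xs : List A) (ys : List B) →
    length (cartesianProduct xs ys) ≡ length xs * length ys
  length-cartesianProduct [] ys = refl
  length-cartesianProduct (x ∷ xs) ys = begin
    length (map (x ,_) ys ++ cartesianProduct xs ys)      ≡⟨ length-++ (map (x ,_) ys) ⟩
    length (map (x ,_) ys) + length (cartesianProduct xs ys)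
      ≡⟨ cong₂ _+_ (length-map (x ,_) ys) (length-cartesianProduct xs ys) ⟩
    length ys + length xs * length ys                    ∎
    where open ≡-Reasoning

  -- Distinct first coordinates give distinct pairs, so one witness per x suffices.
  count-≤-count-cartesianProduct : ∀ (q : A → Bool) (p : A × B → Bool) xs ys →
    (∀ x → q x ≡ true → Σ B λ y → y ∈ ys × p (x , y) ≡ true) →
    count q xs ≤ count p (cartesianProduct xs ys)
  count-≤-count-cartesianProduct q p [] ys witness = z≤n
  count-≤-count-cartesianProduct q p (x ∷ xs) ys witness =
    ≤-trans row-x-and-rest (≤-reflexive (sym (count-++ p (map (x ,_) ys) (cartesianProduct xs ys))))
    where
    row-x-and-rest : count q (x ∷ xs) ≤ count p (map (x ,_) ys) + count p (cartesianProduct xs ys)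
    row-x-and-rest with q x in qx | count-≤-count-cartesianProduct q p xs ys witness
    ... | false | rest = ≤-trans rest (m≤n+m _ _)
    ... | true  | rest with witness x qx
    ...   | y , y∈ys , pxy = +-mono-≤ (count-∈ p (∈-map⁺ (x ,_) y∈ys) pxy) rest

m*2^k+n*2^l≤[m⊔n]*2^suc[k⊔l] : ∀ m n k l →
  m * 2 ^ k + n * 2 ^ l ≤ (m ⊔ n) * 2 ^ suc (k ⊔ l)
m*2^k+n*2^l≤[m⊔n]*2^suc[k⊔l] m n k l = begin
  m * 2 ^ k + n * 2 ^ l
    ≤⟨ +-mono-≤ (*-mono-≤ (m≤m⊔n m n) (^-monoʳ-≤ 2 (m≤m⊔n k l)))
                (*-mono-≤ (m≤n⊔m m n) (^-monoʳ-≤ 2 (m≤n⊔m k l))) ⟩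
  M * K + M * K        ≡⟨ sym (*-distribˡ-+ M K K) ⟩
  M * (K + K)          ≡⟨ cong (λ j → M * (K + j)) (sym (+-identityʳ K)) ⟩
  M * (2 * K)          ∎
  where
  open ≤-Reasoning
  M = m ⊔ n
  K = 2 ^ (k ⊔ l)

module _ {N : ℕ} where

  Input : Set
  Input = Sq N × Sq N × Sq N

  Rect : Set
  Rect = (Sq N → Bool) × (Sq N → Bool) × (Sq N → Bool)

  inRect : Rect → Input → Bool
  inRect (A , B , C) (a , b , c) = A a ∧ B b ∧ C c

  accepts : ∀ {p} → Protocol N p → Input → Bool
  accepts π (a , b , c) = run π a b c

  Accepts : ∀ {p} → Protocol N p → Rect → Set
  Accepts π R = ∀ t → inRect R t ≡ true → accepts π t ≡ true

  input : Fin 3 → Input → Sq N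
  input p (a , b , c) = select p a b c

  restrict : Fin 3 → (Sq N → Bool) → Rect → Rect
  restrict zero             s (A , B , C) = (λ a → A a ∧ s a) , B , C
  restrict (suc zero)       s (A , B , C) = A , (λ b → B b ∧ s b) , C
  restrict (suc (suc zero)) s (A , B , C) = A , B , (λ c → C c ∧ s c)

  inRect-restrict : ∀ p s R t → inRect (restrict p s R) t ≡ inRect R t ∧ s (input p t)
  inRect-restrict zero s (A , B , C) (a , b , c) with A a
  ... | true  = ∧-comm (s a) (B b ∧ C c)
  ... | false = refl
  inRect-restrict (suc zero) s (A , B , C) (a , b , c) with A a | B b
  ... | true  | true  = ∧-comm (s b) (C c)
  ... | true  | false = refl
  ... | false | _     = refl
  inRect-restrict (suc (suc zero)) s (A , B , C) (a , b , c) with A a | B b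
  ... | true  | true  = refl
  ... | true  | false = refl
  ... | false | _     = refl

  inRect-restrict-true : ∀ {p s R t} → inRect (restrict p s R) t ≡ true →
    inRect R t ≡ true × s (input p t) ≡ true
  inRect-restrict-true {p} {s} {R} {t} e =
    let e′ = trans (sym (inRect-restrict p s R t)) e in ∧-conicalˡ _ _ e′ , ∧-conicalʳ _ _ e′

  Accepts-node₀ : ∀ {p} s (π₀ π₁ : Protocol N (nextP p)) R →
    Accepts π₀ R → Accepts (node s π₀ π₁) (restrict p (not ∘ s) R)
  Accepts-node₀ {p} s π₀ π₁ R acc t t∈R′ with inRect-restrict-true {p} {not ∘ s} {R} {t} t∈R′
  ... | t∈R , ¬st with s (input p t)
  ...   | false = acc t t∈R
  Accepts-node₀ s π₀ π₁ R acc t t∈R′ | _ , () | true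

  Accepts-node₁ : ∀ {p} s (π₀ π₁ : Protocol N (nextP p)) R →
    Accepts π₁ R → Accepts (node s π₀ π₁) (restrict p s R)
  Accepts-node₁ {p} s π₀ π₁ R acc t t∈R′ with inRect-restrict-true {p} {s} {R} {t} t∈R′
  ... | t∈R , st rewrite st = acc t t∈R

  count-restrict : ∀ {X : Set} (inp : X → Input) p s R xs →
    count (inRect (restrict p s R) ∘ inp) xs ≡ count (inRect R ∘ inp) (filterᵇ (s ∘ input p ∘ inp) xs)
  count-restrict inp p s R xs =
    trans (count-cong (inRect-restrict p s R ∘ inp) xs) (sym (count-filterᵇ _ _ xs))

  AcceptingRectangleBound : ∀ {X : Set} → (X → Input) → ∀ {p} → Protocol N p → List X → Set
  AcceptingRectangleBound inp π xs =
    Σ Rect λ R → Accepts π R × count (accepts π ∘ inp) xs ≤ count (inRect R ∘ inp) xs * 2 ^ cost π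

  largeAcceptingRectangle : ∀ {X : Set} (inp : X → Input) {p} (π : Protocol N p) xs →
    AcceptingRectangleBound inp π xs
  largeAcceptingRectangle inp (leaf f g h) xs =
    (f , g , h) , (λ _ accepted → accepted) , ≤-reflexive (sym (*-identityʳ _))
  largeAcceptingRectangle inp {p} (node s π₀ π₁) xs
    with largeAcceptingRectangle inp π₀ (filterᵇ (not ∘ s ∘ input p ∘ inp) xs)
       | largeAcceptingRectangle inp π₁ (filterᵇ (s ∘ input p ∘ inp) xs)
  ... | R₀ , acc₀ , le₀ | R₁ , acc₁ , le₁ = choose (⊔-sel c₀ c₁)
    where
    bit : _ → Bool
    bit = s ∘ input p ∘ inp
    c₀ c₁ : ℕ
    c₀ = count (inRect R₀ ∘ inp) (filterᵇ (not ∘ bit) xs)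
    c₁ = count (inRect R₁ ∘ inp) (filterᵇ bit xs)
    total≤ : count (accepts (node s π₀ π₁) ∘ inp) xs ≤ (c₀ ⊔ c₁) * 2 ^ cost (node s π₀ π₁)
    total≤ = begin
      count (accepts (node s π₀ π₁) ∘ inp) xs
        ≡⟨ count-if bit (accepts π₁ ∘ inp) (accepts π₀ ∘ inp) xs ⟩
      count (accepts π₀ ∘ inp) (filterᵇ (not ∘ bit) xs) + count (accepts π₁ ∘ inp) (filterᵇ bit xs)
        ≤⟨ +-mono-≤ le₀ le₁ ⟩
      c₀ * 2 ^ cost π₀ + c₁ * 2 ^ cost π₁
        ≤⟨ m*2^k+n*2^l≤[m⊔n]*2^suc[k⊔l] c₀ c₁ (cost π₀) (cost π₁) ⟩
      (c₀ ⊔ c₁) * 2 ^ cost (node s π₀ π₁) ∎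
      where open ≤-Reasoning
    choose : c₀ ⊔ c₁ ≡ c₀ ⊎ c₀ ⊔ c₁ ≡ c₁ → AcceptingRectangleBound inp (node s π₀ π₁) xs
    choose (inj₁ max≡c₀) = restrict p (not ∘ s) R₀ , Accepts-node₀ s π₀ π₁ R₀ acc₀ ,
      subst (λ c → _ ≤ c * _) (trans max≡c₀ (sym (count-restrict inp p (not ∘ s) R₀ xs))) total≤
    choose (inj₂ max≡c₁) = restrict p s R₁ , Accepts-node₁ s π₀ π₁ R₁ acc₁ ,
      subst (λ c → _ ≤ c * _) (trans max≡c₁ (sym (count-restrict inp p s R₁ xs))) total≤

module _ {N : ℕ} where

  Free : (Sq N → Sq N → Sq N → Set) → Set
  Free S = ∀ a b c a′ b′ c′ → S a b c → S a′ b′ c′ →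
    (a ≡ a′ ⊎ b ≡ b′ ⊎ c ≡ c′) → (a ≡ a′ × b ≡ b′ × c ≡ c′)

  IsFreeDiagonal-⊆ : ∀ (T : Tensor N) {S} → Free S → (∀ a b c → T a b c ≢ 0 → S a b c) →
    IsFreeDiagonal T
  IsFreeDiagonal-⊆ T free T⊆S a b c a′ b′ c′ Tabc≢0 Ta′b′c′≢0 =
    free a b c a′ b′ c′ (T⊆S a b c Tabc≢0) (T⊆S a′ b′ c′ Ta′b′c′≢0)

  =ᶠ-refl : ∀ (i : Fin N) → (i =ᶠ i) ≡ true
  =ᶠ-refl i = Equivalence.to T-≡ (≡⇒≡ᵇ (toℕ i) (toℕ i) refl)

  =ᶠ⇒≡ : ∀ {i j : Fin N} → (i =ᶠ j) ≡ true → i ≡ j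
  =ᶠ⇒≡ {i} {j} i=j = toℕ-injective (≡ᵇ⇒≡ (toℕ i) (toℕ j) (Equivalence.from T-≡ i=j))

  matMul-cycle : ∀ x y z → matMul N (x , y) (y , z) (z , x) ≡ 1
  matMul-cycle x y z rewrite =ᶠ-refl y | =ᶠ-refl z | =ᶠ-refl x = refl

  matMul-support⊆PNOF : ∀ a b c → matMul N a b c ≢ 0 → PNOF a b c
  matMul-support⊆PNOF (i , j) (j′ , k) (k′ , i′) nz
    with j =ᶠ j′ in j=j′ | k =ᶠ k′ in k=k′ | i′ =ᶠ i in i′=i
  ... | true | true | true = =ᶠ⇒≡ j=j′ , =ᶠ⇒≡ k=k′ , =ᶠ⇒≡ i′=i
  ... | false | _ | _ = ⊥-elim (nz refl)
  ... | true | false | _ = ⊥-elim (nz refl)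
  ... | true | true | false = ⊥-elim (nz refl)

  zeroOut-support : ∀ (T : Tensor N) A′ B′ C′ a b c → zeroOut T A′ B′ C′ a b c ≢ 0 →
    inRect (A′ , B′ , C′) (a , b , c) ≡ true × T a b c ≢ 0
  zeroOut-support T A′ B′ C′ a b c nz with A′ a ∧ B′ b ∧ C′ c
  ... | true  = refl , nz
  ... | false = ⊥-elim (nz refl)

  zeroOut-support⊆accepted : ∀ {p} (π : Protocol N p) {Prom Acc} (T : Tensor N) A′ B′ C′ →
    Correct π Prom Acc → Accepts π (A′ , B′ , C′) → (∀ a b c → T a b c ≢ 0 → Prom a b c) →
    ∀ a b c → zeroOut T A′ B′ C′ a b c ≢ 0 → Acc a b c
  zeroOut-support⊆accepted π T A′ B′ C′ correct acc T⊆Prom a b c nz =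
    let inR , Tabc≢0 = zeroOut-support T A′ B′ C′ a b c nz
    in proj₁ (correct a b c (T⊆Prom a b c Tabc≢0)) (acc (a , b , c) inR)

  length-allSq : length (allSq N) ≡ N ^ 2
  length-allSq = begin
    length (allSq N)                            ≡⟨ length-cartesianProduct (allFin N) (allFin N) ⟩
    length (allFin N) * length (allFin N)
      ≡⟨ cong₂ _*_ (length-tabulate {n = N} id) (length-tabulate {n = N} id) ⟩
    N * N                                       ≡⟨ cong (N *_) (sym (*-identityʳ N)) ⟩
    N ^ 2                                       ∎
    where open ≡-Reasoning

  ≢0⇒not-≡ᵇ0 : ∀ n → n ≢ 0 → not (n ≡ᵇ 0) ≡ true
  ≢0⇒not-≡ᵇ0 zero    n≢0 = ⊥-elim (n≢0 refl)
  ≢0⇒not-≡ᵇ0 (suc n) _   = refl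

  count-≤-supportSize : ∀ (T : Tensor N) (q : Sq N → Bool) (f : Sq N → Sq N × Sq N) →
    (∀ a → q a ≡ true → T a (proj₁ (f a)) (proj₂ (f a)) ≢ 0) → count q (allSq N) ≤ supportSize T
  count-≤-supportSize T q f support =
    count-≤-count-cartesianProduct q _ (allSq N) (cartesianProduct (allSq N) (allSq N)) witness
    where
    ∈-allSq : ∀ a → a ∈ allSq N
    ∈-allSq (i , j) = ∈-cartesianProduct⁺ (∈-allFin i) (∈-allFin j)
    witness : ∀ a → q a ≡ true → Σ (Sq N × Sq N) λ bc →
      bc ∈ cartesianProduct (allSq N) (allSq N) × not (T a (proj₁ bc) (proj₂ bc) ≡ᵇ 0) ≡ true
    witness a qa = f a , ∈-cartesianProduct⁺ (∈-allSq (proj₁ (f a))) (∈-allSq (proj₂ (f a))) ,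
                   ≢0⇒not-≡ᵇ0 _ (support a qa)

  zeroOut-inside : ∀ (T : Tensor N) A′ B′ C′ a b c → inRect (A′ , B′ , C′) (a , b , c) ≡ true →
    zeroOut T A′ B′ C′ a b c ≡ T a b c
  zeroOut-inside T A′ B′ C′ a b c inside rewrite inside = refl

  QzoAtLeastFrac-monoʳ : ∀ (T : Tensor N) {num d d′} → d ≤ d′ →
    QzoAtLeastFrac T num d → QzoAtLeastFrac T num d′
  QzoAtLeastFrac-monoʳ T d≤d′ (A′ , B′ , C′ , free , bound) =
    A′ , B′ , C′ , free , ≤-trans bound (*-monoʳ-≤ (supportSize (zeroOut T A′ B′ C′)) d≤d′)

ExactlyOne-unique : ∀ {N} {P : Fin N → Bool} → ExactlyOne P → ∀ {z z′} →
  P z ≡ true → P z′ ≡ true → z ≡ z′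
ExactlyOne-unique (_ , _ , unique) Pz Pz′ = trans (unique _ Pz) (sym (unique _ Pz′))

module PermutationProblem {N} (I : Subset3 N) (isPerm : IsNOFPermutationProblem I) where

  private
    unique-z : ∀ x y → ExactlyOne (λ z → I x y z)
    unique-z = proj₁ isPerm
    unique-x : ∀ y z → ExactlyOne (λ x → I x y z)
    unique-x = proj₁ (proj₂ isPerm)
    unique-y : ∀ x z → ExactlyOne (λ y → I x y z)
    unique-y = proj₂ (proj₂ isPerm)

  third : Fin N → Fin N → Fin N
  third x y = proj₁ (unique-z x y)

  diagonal : Sq N → Input
  diagonal (x , y) = (x , y) , (y , third x y) , (third x y , x)

  diagonal-∈-tildeI : ∀ x y → tildeI I (x , y) (y , third x y) (third x y , x)
  diagonal-∈-tildeI x y = x , y , third x y , refl , refl , refl , proj₁ (proj₂ (unique-z x y))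

  tildeI-free : Free (tildeI I)
  tildeI-free _ _ _ _ _ _ (x , y , z , refl , refl , refl , xyz)
              (_ , _ , z′ , refl , refl , refl , xyz′) (inj₁ refl)
    with ExactlyOne-unique (unique-z x y) xyz xyz′
  ... | refl = refl , refl , refl
  tildeI-free _ _ _ _ _ _ (x , y , z , refl , refl , refl , xyz)
              (x′ , _ , _ , refl , refl , refl , x′yz) (inj₂ (inj₁ refl))
    with ExactlyOne-unique (unique-x y z) xyz x′yz
  ... | refl = refl , refl , refl
  tildeI-free _ _ _ _ _ _ (x , y , z , refl , refl , refl , xyz)
              (_ , y′ , _ , refl , refl , refl , xy′z) (inj₂ (inj₂ refl))
    with ExactlyOne-unique (unique-y x z) xyz xy′z
  ... | refl = refl , refl , refl

  QzoAtLeastFrac-from-acceptingRectangle : ∀ {p} (π : Protocol N p) → Correct π PNOF (tildeI I) →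
    AcceptingRectangleBound diagonal π (allSq N) → QzoAtLeastFrac (matMul N) (N ^ 2) (2 ^ cost π)
  QzoAtLeastFrac-from-acceptingRectangle π correct (R@(A′ , B′ , C′) , acc , le) =
    A′ , B′ , C′ , free , bound
    where
    T′ : Tensor N
    T′ = zeroOut (matMul N) A′ B′ C′
    free : IsFreeDiagonal T′
    free = IsFreeDiagonal-⊆ T′ tildeI-free
      (zeroOut-support⊆accepted π (matMul N) A′ B′ C′ correct acc (matMul-support⊆PNOF {N}))
    diagonal-accepted : ∀ xy → accepts π (diagonal xy) ≡ true
    diagonal-accepted (x , y) = proj₂ (correct _ _ _ (refl , refl , refl)) (diagonal-∈-tildeI x y)
    diagonal-in-support : ∀ xy → inRect R (diagonal xy) ≡ true →
      T′ xy (proj₁ (proj₂ (diagonal xy))) (proj₂ (proj₂ (diagonal xy))) ≢ 0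
    diagonal-in-support (x , y) inside
      rewrite zeroOut-inside (matMul N) A′ B′ C′ _ _ _ inside | matMul-cycle x y (third x y) = λ ()
    bound : N ^ 2 ≤ supportSize T′ * 2 ^ cost π
    bound = begin
      N ^ 2                                              ≡⟨ sym (length-allSq {N}) ⟩
      length (allSq N)
        ≡⟨ sym (count-all {p = accepts π ∘ diagonal} diagonal-accepted (allSq N)) ⟩
      count (accepts π ∘ diagonal) (allSq N)             ≤⟨ le ⟩
      count (inRect R ∘ diagonal) (allSq N) * 2 ^ cost π
        ≤⟨ *-monoˡ-≤ (2 ^ cost π) (count-≤-supportSize T′ _ (proj₂ ∘ diagonal) diagonal-in-support) ⟩
      supportSize T′ * 2 ^ cost π                        ∎
      where open ≤-Reasoning

mainTheorem10 : (N k : ℕ) (I : Subset3 N) → IsNOFPermutationProblem I →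
    CCAtMost PNOF (tildeI I) k → QzoAtLeastFrac (matMul N) (N ^ 2) (2 ^ k)
mainTheorem10 N k I isPerm (π , correct , cost≤k) =
  QzoAtLeastFrac-monoʳ (matMul N) (^-monoʳ-≤ 2 cost≤k)
    (QzoAtLeastFrac-from-acceptingRectangle π correct (largeAcceptingRectangle diagonal π (allSq N)))
  where open PermutationProblem I isPerm
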